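{- For every graph $G$ with at least two vertices, $\kappa_2(\overleftrightarrow{G})=\kappa(G)$.
   Context: $\kappa(G)$ is the usual vertex connectivity of an undirected graph $G$: the minimum size of a vertex set $X$ such that $G-X$ is disconnected or has only one vertex. $\overleftrightarrow{G}$ is the complete biorientation of $G$: the digraph on $V(G)$ obtained by replacing each edge $xy$ of $G$ by the two arcs $xy$ and $yx$. For a digraph $D$ and $S\subseteq V(D)$, strong subgraphs $D_1,\dots,D_p$ of $D$ containing $S$ are $S$-internally disjoint if $V(D_i)\cap V(D_j)=S$ and $A(D_i)\cap A(D_j)=\emptyset$ for all $i<j$; $\kappa_S(D)$ is the maximum number of such subgraphs (a one-vertex digraph counts as strong), and $\kappa_2(D)=\min\{\kappa_S(D): S\subseteq V(D),|S|=2\}$. -}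

module Defs where

open import Data.Nat using (ℕ; _≤_)
open import Data.Bool using (Bool; true; false)
open import Data.Fin using (Fin)
open import Data.Fin.Subset using (Subset; _∈_; _∉_; _⊆_; ∁; ∣_∣)
open import Data.Product using (Σ; _×_; ∃; ∃-syntax)
open import Data.Sum using (_⊎_)
open import Relation.Nullary using (¬_)
open import Relation.Binary.PropositionalEquality using (_≡_; _≢_)
open import Relation.Binary.Construct.Closure.ReflexiveTransitive using (Star)

record Graph (n : ℕ) : Set where
  field
    adj   : Fin n → Fin n → Bool
    sym   : ∀ u v → adj u v ≡ adj v u
    irrefl : ∀ u → adj u u ≡ false
open Graph public

Digraph : ℕ → Set
Digraph n = Fin n → Fin n → Bool

-- Complete biorientation: arcs xy and yx for each edge xy.
biorient : ∀ {n} → Graph n → Digraph n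
biorient G = adj G

EdgeOutside : ∀ {n} → Graph n → Subset n → Fin n → Fin n → Set
EdgeOutside G X u v = (adj G u v ≡ true) × (u ∉ X) × (v ∉ X)

Separates : ∀ {n} → Graph n → Subset n → Set
Separates G X =
  (Σ _ λ u → Σ _ λ v → u ∉ X × v ∉ X × ¬ Star (EdgeOutside G X) u v)
  ⊎ (∣ ∁ X ∣ ≡ 1)

IsVertexConnectivity : ∀ {n} → Graph n → ℕ → Set
IsVertexConnectivity G k =
  (∃[ X ] (∣ X ∣ ≡ k × Separates G X))
  × (∀ X → Separates G X → k ≤ ∣ X ∣)

record Subdigraph (n : ℕ) : Set where
  field
    verts : Subset n
    arcs  : Fin n → Fin n → Bool
open Subdigraph public

Arc : ∀ {n} → Subdigraph n → Fin n → Fin n → Set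
Arc H u v = arcs H u v ≡ true

IsStrongSubgraphContaining : ∀ {n} → Digraph n → Subset n → Subdigraph n → Set
IsStrongSubgraphContaining D S H =
  (∀ u v → Arc H u v → D u v ≡ true)
  × (∀ u v → Arc H u v → (u ∈ verts H) × (v ∈ verts H))
  × (S ⊆ verts H)
  × (∀ u v → u ∈ verts H → v ∈ verts H → Star (Arc H) u v)

IsInternallyDisjointFamily : ∀ {n p} → Digraph n → Subset n → (Fin p → Subdigraph n) → Set
IsInternallyDisjointFamily {n} {p} D S F =
  (∀ i → IsStrongSubgraphContaining D S (F i))
  × (∀ (i j : Fin p) → i ≢ j →
       (∀ x → x ∈ verts (F i) → x ∈ verts (F j) → x ∈ S)
       × (∀ u v → Arc (F i) u v → arcs (F j) u v ≡ false))

IsKappaS : ∀ {n} → Digraph n → Subset n → ℕ → Set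
IsKappaS {n} D S k =
  (Σ (Fin k → Subdigraph n) λ F → IsInternallyDisjointFamily D S F)
  × (∀ p (F : Fin p → Subdigraph n) → IsInternallyDisjointFamily D S F → p ≤ k)

IsKappa2 : ∀ {n} → Digraph n → ℕ → Set
IsKappa2 D k =
  (∃[ S ] (∣ S ∣ ≡ 2 × IsKappaS D S k))
  × (∀ S p → ∣ S ∣ ≡ 2 → IsKappaS D S p → k ≤ p)

-- Upper bound.  Take a minimum separating set X of G.  If G - X is
-- disconnected, pick x, y in different components: every strong subgraph
-- of ↔G containing x and y contains an x–y walk, which must meet X, and
-- internally disjoint subgraphs meet X in distinct vertices; so
-- κ_{x,y}(↔G) ≤ ∣ X ∣.  If G - X is one vertex, any x ≠ y works: the
-- subgraphs leave x by distinct arcs, so there are at most n - 1 = ∣ X ∣.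
--
-- Lower bound.  For any x ≠ y we find κ(G) internally disjoint x–y paths
-- (one of them the edge xy when x, y are adjacent) by Menger's theorem,
-- proved in its A–B form by Göring's induction on the edges, and applied
-- to the neighbourhoods of x and y in G - x - y.  Each x–y path,
-- bioriented, is a strong subgraph containing {x, y}, and disjoint paths
-- give internally disjoint subgraphs.

module Submission where

open import Defs renaming (sym to adj-symmetric)

open import Data.Bool using (true; false) renaming (_≟_ to _≟B_)
open import Data.Empty using (⊥; ⊥-elim)
open import Data.Fin using (Fin; zero; suc)
open import Data.Fin.Properties using (any?; 0≢1+n) renaming (_≟_ to _≟F_; suc-injective to Fin-suc-injective)
open import Data.Fin.Subset using (Subset; inside; outside; _∈_; _∉_; _⊆_; _∪_; _∩_; ∁; _─_; _-_; ⁅_⁆; ∣_∣)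
open import Data.Fin.Subset.Properties
  using ( _∈?_; nonempty?; Empty-unique; ⊆-antisym; p⊆q⇒∣p∣≤∣q∣; ∣⊥∣≡0; ∣⁅x⁆∣≡1
        ; x∈⁅x⁆; x∈⁅y⁆⇒x≡y; x∉⁅y⁆⇒x≢y; x∈p∪q⁺; x∈p∪q⁻; x∈p∩q⁺; x∈p∩q⁻
        ; x∈∁p⇒x∉p; x∉p⇒x∈∁p; x∉∁p⇒x∈p; x∈p⇒x∉∁p; ∣∁p∣≡n∸∣p∣
        ; p─⊥≡p; p─q⊆p; ∣p─q∣≤∣p∣; x∈p∧x∉q⇒x∈p─q; x∈p∧x≢y⇒x∈p-y; x∈p⇒∣p-x∣<∣p∣ )
open import Data.List using (List; []; _∷_; _++_; filter; cartesianProduct; allFin)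
open import Data.List.Membership.Propositional using () renaming (_∈_ to _∈ₗ_)
open import Data.List.Membership.Propositional.Properties
  using (∈-filter⁺; ∈-filter⁻; ∈-cartesianProduct⁺; ∈-allFin; ∈-++⁺ʳ; ∈-++⁻)
import Data.List.Membership.DecPropositional as DecMembership
open import Data.List.Relation.Unary.Any using (here; there)
open import Data.Nat using (ℕ; zero; suc; _≤_; _<_; _∸_; z≤n; s≤s)
open import Data.Nat.Properties
  using (≤-reflexive; ≤-trans; ≤-pred; ≤-antisym; n≤1+n; <-irrefl; <-≤-trans; <⇒≱; ≮⇒≥; _<?_; ∸-monoˡ-≤)
open import Data.Product using (Σ; _×_; _,_; proj₁; proj₂; ∃) renaming (map to ×-map)
open import Data.Sum using (_⊎_; inj₁; inj₂) renaming (map to ⊎-map)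
open import Data.Vec using (tabulate)
open import Data.Vec.Base using (_∷_; here; there)
open import Data.Vec.Properties using (lookup∘tabulate; lookup⇒[]=; []=⇒lookup)
open import Function using (_∘_)
open import Function.Definitions using (Injective)
open import Relation.Binary.Construct.Closure.ReflexiveTransitive
  using (Star; ε; _◅_; _◅◅_; reverse) renaming (map to Star-map)
open import Relation.Binary.PropositionalEquality
  using (_≡_; _≢_; refl; sym; trans; cong; subst; module ≡-Reasoning)
open import Relation.Nullary using (¬_; Dec; yes; no; does; ¬?; _×-dec_; _⊎-dec_; map′)
open import Relation.Nullary.Decidable using (dec-true)

-- Counting in finite subsets.

∈─⇒∉ : ∀ {n} {p q : Subset n} {z} → z ∈ p ─ q → z ∉ q
∈─⇒∉ {p = inside ∷ p} {inside ∷ q} {zero} () here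
∈─⇒∉ {p = _ ∷ p} {_ ∷ q} {suc z} (there h) (there h') = ∈─⇒∉ {p = p} {q} h h'

∈-⇒≢ : ∀ {n} {p : Subset n} {x z} → z ∈ p - x → z ∈ p × z ≢ x
∈-⇒≢ {p = p} {x} h = p─q⊆p p ⁅ x ⁆ h , x∉⁅y⁆⇒x≢y (∈─⇒∉ {p = p} h)

∣p∣≤1+∣p-x∣ : ∀ {n} (p : Subset n) x → ∣ p ∣ ≤ suc ∣ p - x ∣
∣p∣≤1+∣p-x∣ (inside ∷ p) zero = s≤s (≤-reflexive (cong ∣_∣ (sym (p─⊥≡p p))))
∣p∣≤1+∣p-x∣ (outside ∷ p) zero = ≤-trans (≤-reflexive (cong ∣_∣ (sym (p─⊥≡p p)))) (n≤1+n _)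
∣p∣≤1+∣p-x∣ (inside ∷ p) (suc x) = s≤s (∣p∣≤1+∣p-x∣ p x)
∣p∣≤1+∣p-x∣ (outside ∷ p) (suc x) = ∣p∣≤1+∣p-x∣ p x

∣p∪⁅x⁆∣≤1+∣p∣ : ∀ {n} (p : Subset n) x → ∣ p ∪ ⁅ x ⁆ ∣ ≤ suc ∣ p ∣
∣p∪⁅x⁆∣≤1+∣p∣ p x = ≤-trans (∣p∣≤1+∣p-x∣ (p ∪ ⁅ x ⁆) x) (s≤s (p⊆q⇒∣p∣≤∣q∣ back))
  where
  back : p ∪ ⁅ x ⁆ - x ⊆ p
  back h with ∈-⇒≢ {p = p ∪ ⁅ x ⁆} h
  ... | z∈p∪x , z≢x with x∈p∪q⁻ p ⁅ x ⁆ z∈p∪x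
  ...   | inj₁ z∈p = z∈p
  ...   | inj₂ z∈x = ⊥-elim (z≢x (x∈⁅y⁆⇒x≡y x z∈x))

∈∪⁅⁆⁻ : ∀ {n} {S : Subset n} {w z} → z ∈ S ∪ ⁅ w ⁆ → z ∈ S ⊎ z ≡ w
∈∪⁅⁆⁻ {S = S} {w} h with x∈p∪q⁻ S ⁅ w ⁆ h
... | inj₁ z∈S = inj₁ z∈S
... | inj₂ z∈w = inj₂ (x∈⁅y⁆⇒x≡y w z∈w)

∁-involutive : ∀ {n} (p : Subset n) → ∁ (∁ p) ≡ p
∁-involutive p = ⊆-antisym (x∉∁p⇒x∈p ∘ x∈∁p⇒x∉p) (x∉p⇒x∈∁p ∘ x∈p⇒x∉∁p)

injection⇒≤ : ∀ {n k} (f : Fin k → Fin n) → Injective _≡_ _≡_ f →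
  (X : Subset n) → (∀ i → f i ∈ X) → k ≤ ∣ X ∣
injection⇒≤ {k = zero} f f-inj X f∈X = z≤n
injection⇒≤ {k = suc k} f f-inj X f∈X =
  <-≤-trans (s≤s (injection⇒≤ (λ i → f (suc i)) (λ e → Fin-suc-injective (f-inj e)) (X - f zero) rest∈))
            (x∈p⇒∣p-x∣<∣p∣ (f∈X zero))
  where
  rest∈ : ∀ i → f (suc i) ∈ X - f zero
  rest∈ i = x∈p∧x≢y⇒x∈p-y (f∈X (suc i)) (λ e → 0≢1+n (sym (f-inj e)))

_◂_ : ∀ {n k} → Fin n → (Fin k → Fin n) → Fin (suc k) → Fin n
(z ◂ f) zero = z
(z ◂ f) (suc i) = f i

◂-injective : ∀ {n k} {z : Fin n} {f : Fin k → Fin n} →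
  (∀ i → f i ≢ z) → Injective _≡_ _≡_ f → Injective _≡_ _≡_ (z ◂ f)
◂-injective fresh f-inj {zero} {zero} e = refl
◂-injective fresh f-inj {zero} {suc j} e = ⊥-elim (fresh j (sym e))
◂-injective fresh f-inj {suc i} {zero} e = ⊥-elim (fresh i e)
◂-injective fresh f-inj {suc i} {suc j} e = cong suc (f-inj e)

injection-onto : ∀ {n k} (f : Fin k → Fin n) → Injective _≡_ _≡_ f →
  (X : Subset n) → (∀ i → f i ∈ X) → ∣ X ∣ ≤ k → ∀ {z} → z ∈ X → ∃ λ i → f i ≡ z
injection-onto {k = k} f f-inj X f∈X ∣X∣≤k {z} z∈X with any? (λ i → f i ≟F z)
... | yes hit = hit
... | no miss = ⊥-elim (<-irrefl refl (<-≤-trans too-many ∣X∣≤k))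
  where
  too-many : suc k ≤ ∣ X ∣
  too-many = injection⇒≤ (z ◂ f) (◂-injective (λ i e → miss (i , e)) f-inj) X z◂f∈X
    where
    z◂f∈X : ∀ i → (z ◂ f) i ∈ X
    z◂f∈X zero = z∈X
    z◂f∈X (suc i) = f∈X i

choose-distinct : ∀ {n} k (X : Subset n) → k ≤ ∣ X ∣ →
  Σ (Fin k → Fin n) λ f → Injective _≡_ _≡_ f × (∀ i → f i ∈ X)
choose-distinct zero X _ = (λ ()) , (λ {}) , (λ ())
choose-distinct {n} (suc k) X k<∣X∣ with nonempty? X
... | no empty = ⊥-elim (<⇒≱ k<∣X∣ (subst (_≤ k) (sym ∣X∣≡0) z≤n))
  where
  ∣X∣≡0 : ∣ X ∣ ≡ 0
  ∣X∣≡0 = trans (cong ∣_∣ (Empty-unique empty)) (∣⊥∣≡0 n)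
... | yes (z , z∈X) with choose-distinct k (X - z) (≤-pred (≤-trans k<∣X∣ (∣p∣≤1+∣p-x∣ X z)))
...   | f , f-inj , f∈X-z =
  z ◂ f , ◂-injective (λ i → proj₂ (∈-⇒≢ {p = X} (f∈X-z i))) f-inj , ◂∈
  where
  ◂∈ : ∀ i → (z ◂ f) i ∈ X
  ◂∈ zero = z∈X
  ◂∈ (suc i) = proj₁ (∈-⇒≢ {p = X} (f∈X-z i))

pair : ∀ {n} → Fin n → Fin n → Subset n
pair x y = ⁅ x ⁆ ∪ ⁅ y ⁆

∈pair⁺ : ∀ {n} {x y z : Fin n} → z ≡ x ⊎ z ≡ y → z ∈ pair x y
∈pair⁺ {x = x} (inj₁ refl) = x∈p∪q⁺ (inj₁ (x∈⁅x⁆ x))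
∈pair⁺ {y = y} (inj₂ refl) = x∈p∪q⁺ (inj₂ (x∈⁅x⁆ y))

∈pair⁻ : ∀ {n} {x y z : Fin n} → z ∈ pair x y → z ≡ x ⊎ z ≡ y
∈pair⁻ {x = x} {y} h with x∈p∪q⁻ ⁅ x ⁆ ⁅ y ⁆ h
... | inj₁ z∈x = inj₁ (x∈⁅y⁆⇒x≡y x z∈x)
... | inj₂ z∈y = inj₂ (x∈⁅y⁆⇒x≡y y z∈y)

listing : ∀ {n} → Fin n → Fin n → Fin 2 → Fin n
listing x y = x ◂ (y ◂ λ ())

∣pair∣≡2 : ∀ {n} {x y : Fin n} → x ≢ y → ∣ pair x y ∣ ≡ 2
∣pair∣≡2 {x = x} {y} x≢y = ≤-antisym upper (injection⇒≤ (listing x y) listing-inj (pair x y) listing∈)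
  where
  upper : ∣ pair x y ∣ ≤ 2
  upper = ≤-trans (∣p∪⁅x⁆∣≤1+∣p∣ ⁅ x ⁆ y) (s≤s (≤-reflexive (∣⁅x⁆∣≡1 x)))
  listing-inj : Injective _≡_ _≡_ (listing x y)
  listing-inj = ◂-injective (λ { zero e → x≢y (sym e) ; (suc ()) _ }) (◂-injective (λ ()) (λ {}))
  listing∈ : ∀ i → listing x y i ∈ pair x y
  listing∈ zero = ∈pair⁺ (inj₁ refl)
  listing∈ (suc zero) = ∈pair⁺ (inj₂ refl)

two-element : ∀ {n} (S : Subset n) → ∣ S ∣ ≡ 2 →
  Σ (Fin n) λ x → Σ (Fin n) λ y → x ≢ y × S ≡ pair x y
two-element S ∣S∣≡2 with choose-distinct 2 S (≤-reflexive (sym ∣S∣≡2))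
... | f , f-inj , f∈S = f zero , f (suc zero) , (λ e → 0≢1+n (f-inj e)) , ⊆-antisym S⊆ ⊆S
  where
  S⊆ : S ⊆ pair (f zero) (f (suc zero))
  S⊆ z∈S with injection-onto f f-inj S f∈S (≤-reflexive ∣S∣≡2) z∈S
  ... | zero , refl = ∈pair⁺ (inj₁ refl)
  ... | suc zero , refl = ∈pair⁺ (inj₂ refl)
  ⊆S : pair (f zero) (f (suc zero)) ⊆ S
  ⊆S z∈pair with ∈pair⁻ z∈pair
  ... | inj₁ refl = f∈S zero
  ... | inj₂ refl = f∈S (suc zero)

-- Walks avoiding a vertex set, in graphs given by an edge relation.
module _ {n : ℕ} where

  EdgeRel : Set₁
  EdgeRel = Fin n → Fin n → Set

  Avoiding : EdgeRel → Subset n → EdgeRel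
  Avoiding E T u v = E u v × u ∉ T × v ∉ T

  Reach : EdgeRel → Subset n → EdgeRel
  Reach E T = Star (Avoiding E T)

  reach-end∉ : ∀ {E T a b} → a ∉ T → Reach E T a b → b ∉ T
  reach-end∉ a∉T ε = a∉T
  reach-end∉ a∉T ((_ , _ , w∉T) ◅ walk) = reach-end∉ w∉T walk

  reach-reverse : ∀ {E T a b} → (∀ {u v} → E u v → E v u) → Reach E T a b → Reach E T b a
  reach-reverse E-sym = reverse (λ { (e , u∉T , v∉T) → E-sym e , v∉T , u∉T })

  reach-shrink : ∀ {E T T′ a b} → T′ ⊆ T → Reach E T a b → Reach E T′ a b
  reach-shrink T′⊆T = Star-map (λ { (e , u∉T , v∉T) → e , (λ h → u∉T (T′⊆T h)) , (λ h → v∉T (T′⊆T h)) })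

  reach-map : ∀ {E E′ T a b} → (∀ {u v} → E u v → E′ u v) → Reach E T a b → Reach E′ T a b
  reach-map f = Star-map (λ { (e , u∉T , v∉T) → f e , u∉T , v∉T })

  first-hit : ∀ {E T a b} (X : Subset n) → Reach E T a b →
    (a ∉ X × Reach E X a b) ⊎ (∃ λ z → z ∈ X × Reach E T a z)
  first-hit {a = a} X walk with a ∈? X
  ... | yes a∈X = inj₂ (a , a∈X , ε)
  first-hit X ε | no a∉X = inj₁ (a∉X , ε)
  first-hit X ((e , a∉T , w∉T) ◅ walk) | no a∉X with first-hit X walk
  ... | inj₁ (w∉X , rest) = inj₁ (a∉X , (e , a∉X , w∉X) ◅ rest)
  ... | inj₂ (z , z∈X , rest) = inj₂ (z , z∈X , (e , a∉T , w∉T) ◅ rest)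

  ReachedFrom : EdgeRel → Subset n → Subset n → Fin n → Set
  ReachedFrom E T A w = Σ (Fin n) λ a → a ∈ A × a ∉ T × Reach E T a w

  Reaches : EdgeRel → Subset n → Subset n → Fin n → Set
  Reaches E T B w = Σ (Fin n) λ b → b ∈ B × b ∉ T × Reach E T w b

  -- Finite graphs presented by a list of edges; Menger's theorem is
  -- proved by induction on this list.
  EdgeList : Set
  EdgeList = List (Fin n × Fin n)

  Adj : EdgeList → EdgeRel
  Adj L u v = ((u , v) ∈ₗ L) ⊎ ((v , u) ∈ₗ L)

  Adj-sym : ∀ {L u v} → Adj L u v → Adj L v u
  Adj-sym (inj₁ e) = inj₂ e
  Adj-sym (inj₂ e) = inj₁ e

  Adj-there : ∀ {e L u v} → Adj L u v → Adj (e ∷ L) u v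
  Adj-there (inj₁ m) = inj₁ (there m)
  Adj-there (inj₂ m) = inj₂ (there m)

  -- How a walk of L + xy avoiding T meets the new edge xy: not at all,
  -- or it can be shortcut to use it exactly once, as x→y or as y→x.
  ViaEdge : EdgeList → Subset n → Fin n → Fin n → Fin n → Fin n → Set
  ViaEdge L T x y a b = Reach (Adj L) T a b
    ⊎ (Reach (Adj L) T a x × Reach (Adj L) T y b × x ∉ T × y ∉ T)
    ⊎ (Reach (Adj L) T a y × Reach (Adj L) T x b × x ∉ T × y ∉ T)

  ViaEdge-swap : ∀ {L T x y a b} → ViaEdge L T x y a b → ViaEdge L T y x a b
  ViaEdge-swap (inj₁ walk) = inj₁ walk
  ViaEdge-swap (inj₂ (inj₁ (to-x , from-y , x∉T , y∉T))) = inj₂ (inj₂ (to-x , from-y , y∉T , x∉T))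
  ViaEdge-swap (inj₂ (inj₂ (to-y , from-x , x∉T , y∉T))) = inj₂ (inj₁ (to-y , from-x , y∉T , x∉T))

  edge-cases : ∀ {L x y u v} → Adj ((x , y) ∷ L) u v → (u ≡ x × v ≡ y) ⊎ (u ≡ y × v ≡ x) ⊎ Adj L u v
  edge-cases (inj₁ (here refl)) = inj₁ (refl , refl)
  edge-cases (inj₂ (here refl)) = inj₂ (inj₁ (refl , refl))
  edge-cases (inj₁ (there m)) = inj₂ (inj₂ (inj₁ m))
  edge-cases (inj₂ (there m)) = inj₂ (inj₂ (inj₂ m))

  prepend : ∀ {L T x y a w b} → Avoiding (Adj L) T a w → ViaEdge L T x y w b → ViaEdge L T x y a b
  prepend e (inj₁ q) = inj₁ (e ◅ q)
  prepend e (inj₂ (inj₁ (q₁ , rest))) = inj₂ (inj₁ (e ◅ q₁ , rest))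
  prepend e (inj₂ (inj₂ (q₁ , rest))) = inj₂ (inj₂ (e ◅ q₁ , rest))

  -- By induction along the walk; a first step along xy (or yx) replaces
  -- everything up to the last use of the new edge.
  via-edge : ∀ {L T x y a b} → Reach (Adj ((x , y) ∷ L)) T a b → ViaEdge L T x y a b
  via-edge ε = inj₁ ε
  via-edge ((e , a∉T , w∉T) ◅ walk) with edge-cases e | via-edge walk
  ... | inj₂ (inj₂ old) | rest = prepend (old , a∉T , w∉T) rest
  ... | inj₁ (refl , refl) | inj₁ q = inj₂ (inj₁ (ε , q , a∉T , w∉T))
  ... | inj₁ (refl , refl) | inj₂ (inj₁ (_ , q₂ , x∉T , y∉T)) = inj₂ (inj₁ (ε , q₂ , x∉T , y∉T))
  ... | inj₁ (refl , refl) | inj₂ (inj₂ (_ , q₂ , _ , _)) = inj₁ q₂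
  ... | inj₂ (inj₁ (refl , refl)) | inj₁ q = inj₂ (inj₂ (ε , q , w∉T , a∉T))
  ... | inj₂ (inj₁ (refl , refl)) | inj₂ (inj₁ (_ , q₂ , _ , _)) = inj₁ q₂
  ... | inj₂ (inj₁ (refl , refl)) | inj₂ (inj₂ (_ , q₂ , x∉T , y∉T)) = inj₂ (inj₂ (ε , q₂ , x∉T , y∉T))

  via-edge⁻¹ : ∀ {L T x y a b} → ViaEdge L T x y a b → Reach (Adj ((x , y) ∷ L)) T a b
  via-edge⁻¹ (inj₁ q) = reach-map Adj-there q
  via-edge⁻¹ (inj₂ (inj₁ (q₁ , q₂ , x∉T , y∉T))) =
    reach-map Adj-there q₁ ◅◅ ((inj₁ (here refl) , x∉T , y∉T) ◅ reach-map Adj-there q₂)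
  via-edge⁻¹ (inj₂ (inj₂ (q₁ , q₂ , x∉T , y∉T))) =
    reach-map Adj-there q₁ ◅◅ ((inj₂ (here refl) , y∉T , x∉T) ◅ reach-map Adj-there q₂)

  reach? : ∀ L T a b → Dec (Reach (Adj L) T a b)
  reach? [] T a b = map′ (λ { refl → ε }) no-edges (a ≟F b)
    where
    no-edges : Reach (Adj []) T a b → a ≡ b
    no-edges ε = refl
    no-edges ((inj₁ () , _) ◅ _)
    no-edges ((inj₂ () , _) ◅ _)
  reach? ((x , y) ∷ L) T a b = map′ via-edge⁻¹ via-edge
    (reach? L T a b
     ⊎-dec (reach? L T a x ×-dec reach? L T y b ×-dec ¬? (x ∈? T) ×-dec ¬? (y ∈? T))
     ⊎-dec (reach? L T a y ×-dec reach? L T x b ×-dec ¬? (x ∈? T) ×-dec ¬? (y ∈? T)))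

  reaches? : ∀ L T B w → Dec (Reaches (Adj L) T B w)
  reaches? L T B w = any? (λ b → (b ∈? B) ×-dec ¬? (b ∈? T) ×-dec reach? L T w b)

-- Menger's theorem for A–B paths, following Göring's proof by induction
-- on the number of edges (Diestel, Graph Theory, Thm. 3.3.1).
module _ {n : ℕ} where

  -- The rest of an A–B path from its vertex u: it ends in B, meets B only
  -- there, and meets A at most in u.
  data Tail (E : EdgeRel) (A B : Subset n) : Fin n → Set where
    done : ∀ {u} → u ∈ B → Tail E A B u
    step : ∀ {u} v → u ∉ B → E u v → v ∉ A → Tail E A B v → Tail E A B u

  vertices : ∀ {E A B u} → Tail E A B u → List (Fin n)
  vertices {u = u} (done _) = u ∷ []
  vertices {u = u} (step _ _ _ _ t) = u ∷ vertices t

  endpoint : ∀ {E A B u} → Tail E A B u → Fin n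
  endpoint {u = u} (done _) = u
  endpoint (step _ _ _ _ t) = endpoint t

  endpoint∈B : ∀ {E A B u} (t : Tail E A B u) → endpoint t ∈ B
  endpoint∈B (done u∈B) = u∈B
  endpoint∈B (step _ _ _ _ t) = endpoint∈B t

  start∈vertices : ∀ {E A B u} (t : Tail E A B u) → u ∈ₗ vertices t
  start∈vertices (done _) = here refl
  start∈vertices (step _ _ _ _ _) = here refl

  endpoint∈vertices : ∀ {E A B u} (t : Tail E A B u) → endpoint t ∈ₗ vertices t
  endpoint∈vertices (done _) = here refl
  endpoint∈vertices (step _ _ _ _ t) = there (endpoint∈vertices t)

  tail-map : ∀ {E E′ A B u} → (∀ {a b} → E a b → E′ a b) → Tail E A B u → Tail E′ A B u
  tail-map f (done u∈B) = done u∈B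
  tail-map f (step v u∉B e v∉A t) = step v u∉B (f e) v∉A (tail-map f t)

  tail-map-vertices : ∀ {E E′ A B u} (f : ∀ {a b} → E a b → E′ a b) (t : Tail E A B u) →
    vertices (tail-map {E′ = E′} f t) ≡ vertices t
  tail-map-vertices f (done _) = refl
  tail-map-vertices f (step _ _ _ _ t) = cong (_ ∷_) (tail-map-vertices f t)

  ABPath : EdgeRel → Subset n → Subset n → Set
  ABPath E A B = Σ (Fin n) λ a → a ∈ A × Tail E A B a

  path-vertices : ∀ {E A B} → ABPath E A B → List (Fin n)
  path-vertices (_ , _ , t) = vertices t

  DisjointPaths : EdgeRel → Subset n → Subset n → ℕ → Set
  DisjointPaths E A B k = Σ (Fin k → ABPath E A B) λ P →
    ∀ i j → i ≢ j → ∀ w → w ∈ₗ path-vertices (P i) → w ∈ₗ path-vertices (P j) → ⊥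

  disjoint-paths-map : ∀ {E E′ A B k} → (∀ {a b} → E a b → E′ a b) →
    DisjointPaths E A B k → DisjointPaths E′ A B k
  disjoint-paths-map {E′ = E′} f (P , disjoint) =
    (λ i → proj₁ (P i) , proj₁ (proj₂ (P i)) , tail-map f (proj₂ (proj₂ (P i)))) ,
    λ i j i≢j w w∈i w∈j → disjoint i j i≢j w (subst (w ∈ₗ_) (tail-map-vertices {E′ = E′} f _) w∈i)
                                              (subst (w ∈ₗ_) (tail-map-vertices {E′ = E′} f _) w∈j)

  disjoint⇒injective : ∀ {E A B k} ((P , _) : DisjointPaths E A B k) (f : Fin k → Fin n) →
    (∀ i → f i ∈ₗ path-vertices (P i)) → Injective _≡_ _≡_ f
  disjoint⇒injective (P , disjoint) f f∈P {i} {j} fi≡fj with i ≟F j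
  ... | yes i≡j = i≡j
  ... | no i≢j = ⊥-elim (disjoint i j i≢j (f i) (f∈P i) (subst (_∈ₗ path-vertices (P j)) (sym fi≡fj) (f∈P j)))

  ABSeparator : EdgeRel → Subset n → Subset n → Subset n → Set
  ABSeparator E A B T = ∀ a b → a ∈ A → b ∈ B → a ∉ T → b ∉ T → ¬ Reach E T a b

  separator-sym : ∀ {E A B T} → (∀ {u v} → E u v → E v u) → ABSeparator E A B T → ABSeparator E B A T
  separator-sym E-sym sep a b a∈B b∈A a∉T b∉T walk = sep b a b∈A a∈B b∉T a∉T (reach-reverse E-sym walk)

  Menger : EdgeRel → Subset n → Subset n → ℕ → Set
  Menger E A B k = DisjointPaths E A B k ⊎ (Σ (Subset n) λ T → ABSeparator E A B T × ∣ T ∣ < k)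

  separator-or-walk : ∀ L A B T → ABSeparator (Adj L) A B T ⊎
    (Σ (Fin n) λ a → Σ (Fin n) λ b → a ∈ A × b ∈ B × a ∉ T × b ∉ T × Reach (Adj L) T a b)
  separator-or-walk L A B T with any? (λ a → any? (λ b →
    (a ∈? A) ×-dec (b ∈? B) ×-dec ¬? (a ∈? T) ×-dec ¬? (b ∈? T) ×-dec reach? L T a b))
  ... | yes (a , b , walk) = inj₂ (a , b , walk)
  ... | no none = inj₁ (λ a b a∈A b∈B a∉T b∉T walk → none (a , b , a∈A , b∈B , a∉T , b∉T , walk))

  separator-lift : ∀ {L E x y A B S X T} →
    (∀ {T a b} → Reach E T a b → ViaEdge L T x y a b) →
    ABSeparator (Adj L) A B S → (∀ a → a ∈ A → a ∉ S → ¬ Reach (Adj L) S a y) →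
    S ⊆ X → x ∈ X → ABSeparator (Adj L) A X T → ABSeparator E A B T
  separator-lift {X = X} via sepS A↛y S⊆X x∈X sepT a b a∈A b∈B a∉T b∉T walk with via walk
  ... | inj₁ old with first-hit X old
  ...   | inj₁ (a∉X , avoids-X) =
          sepS a b a∈A b∈B (λ h → a∉X (S⊆X h)) (λ h → reach-end∉ a∉X avoids-X (S⊆X h))
               (reach-shrink S⊆X avoids-X)
  ...   | inj₂ (z , z∈X , to-z) = sepT a z a∈A z∈X a∉T (reach-end∉ a∉T to-z) to-z
  separator-lift via sepS A↛y S⊆X x∈X sepT a b a∈A b∈B a∉T b∉T walk | inj₂ (inj₁ (to-x , _ , x∉T , _)) =
    sepT a _ a∈A x∈X a∉T x∉T to-x
  separator-lift {X = X} via sepS A↛y S⊆X x∈X sepT a b a∈A b∈B a∉T b∉T walk | inj₂ (inj₂ (to-y , _ , _ , _))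
    with first-hit X to-y
  ... | inj₁ (a∉X , avoids-X) = A↛y a a∈A (λ h → a∉X (S⊆X h)) (reach-shrink S⊆X avoids-X)
  ... | inj₂ (z , z∈X , to-z) = sepT a z a∈A z∈X a∉T (reach-end∉ a∉T to-z) to-z

  -- The graph E is L plus the
  -- edge xy; by induction Menger holds in L for every A′, B′, and the
  -- separator S of L (∣ S ∣ < k) is crossed in E by a walk through xy, so
  -- x is reached from A and y reaches B in L - S.  Apply the induction
  -- hypothesis to A, X = S ∪ {x} and to Y = S ∪ {y}, B: a small separator
  -- of either lifts to E, and otherwise k disjoint A–X paths and k disjoint
  -- Y–B paths glue, along the bijection X → Y fixing S, into k disjoint
  -- A–B paths of E.
  module MengerStep {L : EdgeList} {E : EdgeRel} (E-sym : ∀ {u v} → E u v → E v u)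
    (L⊆E : ∀ {u v} → Adj L u v → E u v) {x y : Fin n}
    (via : ∀ {T a b} → Reach E T a b → ViaEdge L T x y a b) (xy : E x y)
    {A B S : Subset n} (sepS : ABSeparator (Adj L) A B S) (k : ℕ) (∣S∣<k : ∣ S ∣ < k)
    (x-from-A : ReachedFrom (Adj L) S A x) (y-to-B : Reaches (Adj L) S B y)
    (induction : ∀ A′ B′ → Menger (Adj L) A′ B′ k) where

    FromA ToB : Fin n → Set
    FromA = ReachedFrom (Adj L) S A
    ToB = Reaches (Adj L) S B

    ¬FromA×ToB : ∀ {w} → FromA w → ToB w → ⊥
    ¬FromA×ToB (a , a∈A , a∉S , p) (b , b∈B , b∉S , q) = sepS a b a∈A b∈B a∉S b∉S (p ◅◅ q)

    FromA⇒∉S : ∀ {w} → FromA w → w ∉ S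
    FromA⇒∉S (_ , _ , a∉S , p) = reach-end∉ a∉S p

    ToB⇒∉S : ∀ {w} → ToB w → w ∉ S
    ToB⇒∉S (_ , _ , b∉S , q) = reach-end∉ b∉S (reach-reverse Adj-sym q)

    FromA⇒∉B : ∀ {w} → FromA w → w ∉ B
    FromA⇒∉B {w} from w∈B = ¬FromA×ToB from (w , w∈B , FromA⇒∉S from , ε)

    ToB⇒∉A : ∀ {w} → ToB w → w ∉ A
    ToB⇒∉A {w} to w∈A = ¬FromA×ToB (w , w∈A , ToB⇒∉S to , ε) to

    x≢y : x ≢ y
    x≢y refl = ¬FromA×ToB x-from-A y-to-B

    X Y : Subset n
    X = S ∪ ⁅ x ⁆
    Y = S ∪ ⁅ y ⁆

    S⊆X : S ⊆ X
    S⊆X h = x∈p∪q⁺ (inj₁ h)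
    S⊆Y : S ⊆ Y
    S⊆Y h = x∈p∪q⁺ (inj₁ h)
    x∈X : x ∈ X
    x∈X = x∈p∪q⁺ (inj₂ (x∈⁅x⁆ x))
    y∈Y : y ∈ Y
    y∈Y = x∈p∪q⁺ (inj₂ (x∈⁅x⁆ y))

    y∉X : y ∉ X
    y∉X h with ∈∪⁅⁆⁻ {S = S} h
    ... | inj₁ y∈S = ToB⇒∉S y-to-B y∈S
    ... | inj₂ y≡x = x≢y (sym y≡x)

    module Glue (Pfam : DisjointPaths (Adj L) A X k) (Qfam : DisjointPaths (Adj L) Y B k) where
      P : Fin k → ABPath (Adj L) A X
      P = proj₁ Pfam
      Q : Fin k → ABPath (Adj L) Y B
      Q = proj₁ Qfam

      tailP : ∀ i → Tail (Adj L) A X (proj₁ (P i))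
      tailP i = proj₂ (proj₂ (P i))
      tailQ : ∀ j → Tail (Adj L) Y B (proj₁ (Q j))
      tailQ j = proj₂ (proj₂ (Q j))

      endP : Fin k → Fin n
      endP i = endpoint (tailP i)
      endP∈X : ∀ i → endP i ∈ X
      endP∈X i = endpoint∈B (tailP i)
      endP-injective : Injective _≡_ _≡_ endP
      endP-injective = disjoint⇒injective Pfam endP (λ i → endpoint∈vertices (tailP i))

      startQ : Fin k → Fin n
      startQ j = proj₁ (Q j)
      startQ∈Y : ∀ j → startQ j ∈ Y
      startQ∈Y j = proj₁ (proj₂ (Q j))
      startQ-injective : Injective _≡_ _≡_ startQ
      startQ-injective = disjoint⇒injective Qfam startQ (λ j → start∈vertices (tailQ j))

      match : Fin n → Fin n
      match z with z ≟F x
      ... | yes _ = y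
      ... | no _ = z

      match-cases : ∀ z → (z ≡ x × match z ≡ y) ⊎ (z ≢ x × match z ≡ z)
      match-cases z with z ≟F x
      ... | yes z≡x = inj₁ (z≡x , refl)
      ... | no z≢x = inj₂ (z≢x , refl)

      match∈Y : ∀ {z} → z ∈ X → match z ∈ Y
      match∈Y {z} z∈X with match-cases z
      ... | inj₁ (_ , m≡y) = subst (_∈ Y) (sym m≡y) y∈Y
      ... | inj₂ (z≢x , m≡z) with ∈∪⁅⁆⁻ {S = S} z∈X
      ...   | inj₁ z∈S = subst (_∈ Y) (sym m≡z) (S⊆Y z∈S)
      ...   | inj₂ z≡x = ⊥-elim (z≢x z≡x)

      match-injective : ∀ {z₁ z₂} → z₁ ∈ X → z₂ ∈ X → match z₁ ≡ match z₂ → z₁ ≡ z₂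
      match-injective {z₁} {z₂} z₁∈X z₂∈X m≡m with match-cases z₁ | match-cases z₂
      ... | inj₁ (z₁≡x , _) | inj₁ (z₂≡x , _) = trans z₁≡x (sym z₂≡x)
      ... | inj₁ (_ , m₁≡y) | inj₂ (_ , m₂≡z₂) =
        ⊥-elim (y∉X (subst (_∈ X) (trans (sym m₂≡z₂) (trans (sym m≡m) m₁≡y)) z₂∈X))
      ... | inj₂ (_ , m₁≡z₁) | inj₁ (_ , m₂≡y) =
        ⊥-elim (y∉X (subst (_∈ X) (trans (sym m₁≡z₁) (trans m≡m m₂≡y)) z₁∈X))
      ... | inj₂ (_ , m₁≡z₁) | inj₂ (_ , m₂≡z₂) = trans (sym m₁≡z₁) (trans m≡m m₂≡z₂)

      -- The k starts of the Q-paths exhaust Y, so every P-path has a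
      -- partner Q-path starting at the match of its end.
      ∣Y∣≤k : ∣ Y ∣ ≤ k
      ∣Y∣≤k = ≤-trans (∣p∪⁅x⁆∣≤1+∣p∣ S y) ∣S∣<k

      partner : Fin k → Fin k
      partner i = proj₁ (injection-onto startQ startQ-injective Y startQ∈Y ∣Y∣≤k (match∈Y (endP∈X i)))

      partner-start : ∀ i → startQ (partner i) ≡ match (endP i)
      partner-start i = proj₂ (injection-onto startQ startQ-injective Y startQ∈Y ∣Y∣≤k (match∈Y (endP∈X i)))

      from-A-onward : ∀ {u v} → (u ∉ X → FromA u) → u ∉ X → Adj L u v → v ∉ X → FromA v
      from-A-onward from-A u∉X e v∉X with from-A u∉X
      ... | a , a∈A , a∉S , p = a , a∈A , a∉S , p ◅◅ ((e , (λ h → u∉X (S⊆X h)) , (λ h → v∉X (S⊆X h))) ◅ ε)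

      to-B : ∀ {v} (r : Tail (Adj L) Y B v) → v ∉ Y → ToB v
      to-B {v} (done v∈B) v∉Y = v , v∈B , (λ h → v∉Y (S⊆Y h)) , ε
      to-B {v} (step w _ e w∉Y r) v∉Y with to-B r w∉Y
      ... | b , b∈B , b∉S , q = b , b∈B , b∉S , (e , (λ h → v∉Y (S⊆Y h)) , (λ h → w∉Y (S⊆Y h))) ◅ q

      lift-Q : ∀ {s} → Tail (Adj L) Y B s → Tail E A B s
      lift-Q (done s∈B) = done s∈B
      lift-Q (step w s∉B e w∉Y r) = step w s∉B (L⊆E e) (ToB⇒∉A (to-B r w∉Y)) (lift-Q r)

      lift-Q-vertices : ∀ {s} (r : Tail (Adj L) Y B s) → vertices (lift-Q r) ≡ vertices r
      lift-Q-vertices (done _) = refl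
      lift-Q-vertices (step _ _ _ _ r) = cong (_ ∷_) (lift-Q-vertices r)

      glue : ∀ {u} (t : Tail (Adj L) A X u) → (u ∉ X → FromA u) → Tail E A B (endpoint t) → Tail E A B u
      glue (done _) from-A c = c
      glue (step v u∉X e v∉A t) from-A c =
        step v (FromA⇒∉B (from-A u∉X)) (L⊆E e) v∉A (glue t (from-A-onward from-A u∉X e) c)

      glue-vertices : ∀ {u w} (t : Tail (Adj L) A X u) (from-A : u ∉ X → FromA u) (c : Tail E A B (endpoint t)) →
        w ∈ₗ vertices (glue t from-A c) → w ∈ₗ vertices t ⊎ w ∈ₗ vertices c
      glue-vertices (done _) from-A c m = inj₂ m
      glue-vertices (step _ _ _ _ t) from-A c (here refl) = inj₁ (here refl)
      glue-vertices (step _ _ _ _ t) from-A c (there m) with glue-vertices t _ c m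
      ... | inj₁ m′ = inj₁ (there m′)
      ... | inj₂ m′ = inj₂ m′

      P-vertex-cases : ∀ {u w} (t : Tail (Adj L) A X u) → (u ∉ X → FromA u) →
        w ∈ₗ vertices t → w ≡ endpoint t ⊎ (w ∉ X × FromA w)
      P-vertex-cases (done _) from-A (here refl) = inj₁ refl
      P-vertex-cases (step _ u∉X _ _ _) from-A (here refl) = inj₂ (u∉X , from-A u∉X)
      P-vertex-cases (step _ u∉X e _ t) from-A (there m) = P-vertex-cases t (from-A-onward from-A u∉X e) m

      Q-vertex-cases : ∀ {s w} (r : Tail (Adj L) Y B s) → w ∈ₗ vertices r → w ≡ s ⊎ (w ∉ Y × ToB w)
      Q-vertex-cases (done _) (here refl) = inj₁ refl
      Q-vertex-cases (step _ _ _ _ _) (here refl) = inj₁ refl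
      Q-vertex-cases (step _ _ _ w∉Y r) (there m) = inj₂ (inner r w∉Y m)
        where
        inner : ∀ {v w} (r : Tail (Adj L) Y B v) → v ∉ Y → w ∈ₗ vertices r → w ∉ Y × ToB w
        inner r@(done _) v∉Y (here refl) = v∉Y , to-B r v∉Y
        inner r@(step _ _ _ _ _) v∉Y (here refl) = v∉Y , to-B r v∉Y
        inner (step _ _ _ w∉Y r) _ (there m) = inner r w∉Y m

      -- From the end z ∉ B of a P-path, continue along the partner Q-path
      -- (through the edge xy when z = x); the continuation only uses z and
      -- vertices of the Q-path.
      Continuation : Fin n → List (Fin n) → Set
      Continuation z l = Σ (Tail E A B z) λ c → ∀ w → w ∈ₗ vertices c → w ≡ z ⊎ w ∈ₗ l

      continue : ∀ {z s} → z ∉ B → (r : Tail (Adj L) Y B s) → s ≡ match z → Continuation z (vertices r)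
      continue {z} z∉B r s≡mz with match-cases z
      ... | inj₁ (refl , m≡y) = via-xy r (trans s≡mz m≡y)
        where
        via-xy : ∀ {s} (r : Tail (Adj L) Y B s) → s ≡ y → Continuation x (vertices r)
        via-xy r refl = step y z∉B xy (ToB⇒∉A y-to-B) (lift-Q r) ,
          λ { w (here refl) → inj₁ refl ; w (there m) → inj₂ (subst (w ∈ₗ_) (lift-Q-vertices r) m) }
      ... | inj₂ (_ , m≡z) = directly r (trans s≡mz m≡z)
        where
        directly : ∀ {s} (r : Tail (Adj L) Y B s) → s ≡ z → Continuation z (vertices r)
        directly r refl = lift-Q r , λ w m → inj₂ (subst (w ∈ₗ_) (lift-Q-vertices r) m)

      Combined : ∀ {a s} → Tail (Adj L) A X a → Tail (Adj L) Y B s → Set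
      Combined t r = Σ (ABPath E A B) λ c → ∀ w → w ∈ₗ path-vertices c → w ∈ₗ vertices t ⊎ w ∈ₗ vertices r

      combine : ∀ {a s} → a ∈ A → (t : Tail (Adj L) A X a) (r : Tail (Adj L) Y B s) →
        s ≡ match (endpoint t) → Combined t r
      combine {a} a∈A t r s≡m with endpoint t ∈? B
      ... | yes z∈B =
        (a , a∈A , glue t start-from-A (done z∈B)) , λ w m → covered (glue-vertices t start-from-A (done z∈B) m)
        where
        start-from-A : a ∉ X → FromA a
        start-from-A a∉X = a , a∈A , (λ h → a∉X (S⊆X h)) , ε
        covered : ∀ {w} → w ∈ₗ vertices t ⊎ w ∈ₗ (endpoint t ∷ []) → w ∈ₗ vertices t ⊎ w ∈ₗ vertices r
        covered (inj₁ m) = inj₁ m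
        covered (inj₂ (here refl)) = inj₁ (endpoint∈vertices t)
      ... | no z∉B with endpoint t ∈? A | continue z∉B r s≡m
      ...   | yes z∈A | c , c-covered = (endpoint t , z∈A , c) , λ w m → covered (c-covered w m)
        where
        covered : ∀ {w} → w ≡ endpoint t ⊎ w ∈ₗ vertices r → w ∈ₗ vertices t ⊎ w ∈ₗ vertices r
        covered (inj₁ refl) = inj₁ (endpoint∈vertices t)
        covered (inj₂ m) = inj₂ m
      ...   | no z∉A | c , c-covered = (a , a∈A , glue t start-from-A c) , λ w m → covered (glue-vertices t start-from-A c m)
        where
        start-from-A : a ∉ X → FromA a
        start-from-A a∉X = a , a∈A , (λ h → a∉X (S⊆X h)) , ε
        covered : ∀ {w} → w ∈ₗ vertices t ⊎ w ∈ₗ vertices c → w ∈ₗ vertices t ⊎ w ∈ₗ vertices r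
        covered (inj₁ m) = inj₁ m
        covered {w} (inj₂ m) with c-covered w m
        ... | inj₁ refl = inj₁ (endpoint∈vertices t)
        ... | inj₂ m′ = inj₂ m′

      combined : ∀ i → Combined (tailP i) (tailQ (partner i))
      combined i = combine (proj₁ (proj₂ (P i))) (tailP i) (tailQ (partner i)) (partner-start i)

      -- A P-path and the partner of a different P-path never meet: the
      -- shared vertex would be a common end (contradicting injectivity of
      -- the matching), lie in S ∪ {x} and outside S ∪ {y}, or be both
      -- reached from A and reaching B.
      P-meets-other-Q : ∀ i i′ → i ≢ i′ → ∀ w →
        w ∈ₗ vertices (tailP i) → w ∈ₗ vertices (tailQ (partner i′)) → ⊥
      P-meets-other-Q i i′ i≢i′ w w∈P w∈Q
        with P-vertex-cases (tailP i) (λ a∉X → _ , proj₁ (proj₂ (P i)) , (λ h → a∉X (S⊆X h)) , ε) w∈P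
           | Q-vertex-cases (tailQ (partner i′)) w∈Q
      ... | inj₁ w≡end | inj₁ w≡start =
        ends-differ (match-cases (endP i′)) (trans (sym w≡end) (trans w≡start (partner-start i′)))
        where
        ends-differ : (endP i′ ≡ x × match (endP i′) ≡ y) ⊎ (endP i′ ≢ x × match (endP i′) ≡ endP i′) →
          endP i ≡ match (endP i′) → ⊥
        ends-differ (inj₁ (_ , m≡y)) e = y∉X (subst (_∈ X) (trans e m≡y) (endP∈X i))
        ends-differ (inj₂ (_ , m≡end)) e = i≢i′ (endP-injective (trans e m≡end))
      P-meets-other-Q i i′ i≢i′ w w∈P w∈Q | inj₁ w≡end | inj₂ (w∉Y , w-to-B)
        with ∈∪⁅⁆⁻ {S = S} (subst (_∈ X) (sym w≡end) (endP∈X i))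
      ... | inj₁ w∈S = w∉Y (S⊆Y w∈S)
      ... | inj₂ refl = ¬FromA×ToB x-from-A w-to-B
      P-meets-other-Q i i′ i≢i′ w w∈P w∈Q | inj₂ (w∉X , w-from-A) | inj₁ w≡start
        with ∈∪⁅⁆⁻ {S = S} (subst (_∈ Y) (sym w≡start) (startQ∈Y (partner i′)))
      ... | inj₁ w∈S = w∉X (S⊆X w∈S)
      ... | inj₂ refl = ¬FromA×ToB w-from-A y-to-B
      P-meets-other-Q i i′ i≢i′ w w∈P w∈Q | inj₂ (_ , w-from-A) | inj₂ (_ , w-to-B) = ¬FromA×ToB w-from-A w-to-B

      glued : DisjointPaths E A B k
      glued = (λ i → proj₁ (combined i)) , disjoint
        where
        disjoint : ∀ i i′ → i ≢ i′ → ∀ w → w ∈ₗ path-vertices (proj₁ (combined i)) →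
          w ∈ₗ path-vertices (proj₁ (combined i′)) → ⊥
        disjoint i i′ i≢i′ w m m′ with proj₂ (combined i) w m | proj₂ (combined i′) w m′
        ... | inj₁ p | inj₁ p′ = proj₂ Pfam i i′ i≢i′ w p p′
        ... | inj₁ p | inj₂ q′ = P-meets-other-Q i i′ i≢i′ w p q′
        ... | inj₂ q | inj₁ p′ = P-meets-other-Q i′ i (λ e → i≢i′ (sym e)) w p′ q
        ... | inj₂ q | inj₂ q′ with partner i ≟F partner i′
        ...   | no partners≢ = proj₂ Qfam (partner i) (partner i′) partners≢ w q q′
        ...   | yes partners≡ = i≢i′ (endP-injective (match-injective (endP∈X i) (endP∈X i′)
                  (trans (sym (partner-start i)) (trans (cong startQ partners≡) (partner-start i′)))))

    step-result : Menger E A B k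
    step-result with induction A X | induction Y B
    ... | inj₂ (T , T-separates , ∣T∣<k) | _ =
      inj₂ (T , separator-lift via sepS A↛y S⊆X x∈X T-separates , ∣T∣<k)
      where
      A↛y : ∀ a → a ∈ A → a ∉ S → ¬ Reach (Adj L) S a y
      A↛y a a∈A a∉S walk = ¬FromA×ToB (a , a∈A , a∉S , walk) y-to-B
    ... | inj₁ _ | inj₂ (T , T-separates , ∣T∣<k) =
      inj₂ (T , separator-sym E-sym (separator-lift (λ walk → ViaEdge-swap (via walk)) (separator-sym Adj-sym sepS)
                                        x↚B S⊆Y y∈Y (separator-sym Adj-sym T-separates)) , ∣T∣<k)
      where
      x↚B : ∀ b → b ∈ B → b ∉ S → ¬ Reach (Adj L) S b x
      x↚B b b∈B b∉S walk = ¬FromA×ToB x-from-A (b , b∈B , b∉S , reach-reverse Adj-sym walk)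
    ... | inj₁ Pfam | inj₁ Qfam = inj₁ (Glue.glued Pfam Qfam)

  menger : ∀ L A B k → Menger (Adj L) A B k
  menger [] A B k with ∣ A ∩ B ∣ <? k
  ... | yes small = inj₂ (A ∩ B , common-separates , small)
    where
    common-separates : ABSeparator (Adj []) A B (A ∩ B)
    common-separates a b a∈A b∈B a∉A∩B _ ε = a∉A∩B (x∈p∩q⁺ (a∈A , b∈B))
    common-separates a b a∈A b∈B _ _ ((inj₁ () , _) ◅ _)
    common-separates a b a∈A b∈B _ _ ((inj₂ () , _) ◅ _)
  ... | no large with choose-distinct k (A ∩ B) (≮⇒≥ large)
  ...   | f , f-injective , f∈A∩B = inj₁ (trivial-path , disjoint)
    where
    trivial-path : Fin k → ABPath (Adj []) A B
    trivial-path i = f i , proj₁ (x∈p∩q⁻ A B (f∈A∩B i)) , done (proj₂ (x∈p∩q⁻ A B (f∈A∩B i)))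
    disjoint : ∀ i j → i ≢ j → ∀ w → w ∈ₗ f i ∷ [] → w ∈ₗ f j ∷ [] → ⊥
    disjoint i j i≢j w (here refl) (here fi≡fj) = i≢j (f-injective fi≡fj)
  menger ((x , y) ∷ L) A B k with menger L A B k
  ... | inj₁ paths = inj₁ (disjoint-paths-map Adj-there paths)
  ... | inj₂ (S , S-separates , ∣S∣<k) with separator-or-walk ((x , y) ∷ L) A B S
  ...   | inj₁ still-separates = inj₂ (S , still-separates , ∣S∣<k)
  ...   | inj₂ (a , b , a∈A , b∈B , a∉S , b∉S , walk) with via-edge walk
  ...     | inj₁ old = ⊥-elim (S-separates a b a∈A b∈B a∉S b∉S old)
  ...     | inj₂ (inj₁ (to-x , from-y , _ , _)) =
    MengerStep.step-result Adj-sym Adj-there via-edge (inj₁ (here refl)) S-separates k ∣S∣<k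
      (a , a∈A , a∉S , to-x) (b , b∈B , b∉S , from-y) (λ A′ B′ → menger L A′ B′ k)
  ...     | inj₂ (inj₂ (to-y , from-x , _ , _)) =
    MengerStep.step-result Adj-sym Adj-there (λ walk → ViaEdge-swap (via-edge walk)) (inj₂ (here refl)) S-separates k ∣S∣<k
      (a , a∈A , a∉S , to-y) (b , b∈B , b∉S , from-x) (λ A′ B′ → menger L A′ B′ k)

module _ {n : ℕ} where

  subset : {P : Fin n → Set} → (∀ v → Dec (P v)) → Subset n
  subset P? = tabulate (λ v → does (P? v))

  ∈subset⁺ : ∀ {P : Fin n → Set} (P? : ∀ v → Dec (P v)) {v} → P v → v ∈ subset P?
  ∈subset⁺ P? {v} p = lookup⇒[]= v _ (trans (lookup∘tabulate _ v) (dec-true (P? v) p))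

  ∈subset⁻ : ∀ {P : Fin n → Set} (P? : ∀ v → Dec (P v)) {v} → v ∈ subset P? → P v
  ∈subset⁻ P? {v} h with P? v | trans (sym (lookup∘tabulate (λ v → does (P? v)) v)) ([]=⇒lookup h)
  ... | yes p | _ = p
  ... | no _ | ()

-- Internally disjoint x–y paths are A–B paths in G - x - y, where A and
-- B are the other neighbours of x and of y.  If every separating set of G
-- has at least k vertices, there are k such paths when x, y are not
-- adjacent, and k - 1 when they are.
module LocalMenger {n : ℕ} (G : Graph n) (x y : Fin n) (x≢y : x ≢ y) where

  Edge : EdgeRel
  Edge u v = adj G u v ≡ true

  edge? : ∀ u v → Dec (Edge u v)
  edge? u v = adj G u v ≟B true

  edge-sym : ∀ {u v} → Edge u v → Edge v u
  edge-sym {u} {v} e = trans (adj-symmetric G v u) e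

  Inner : Fin n → Set
  Inner w = w ≢ x × w ≢ y

  inner? : ∀ w → Dec (Inner w)
  inner? w = ¬? (w ≟F x) ×-dec ¬? (w ≟F y)

  inner∉pair : ∀ {w} → Inner w → w ∉ pair x y
  inner∉pair (w≢x , w≢y) h with ∈pair⁻ h
  ... | inj₁ w≡x = w≢x w≡x
  ... | inj₂ w≡y = w≢y w≡y

  inner-edges : EdgeList
  inner-edges = filter (λ (u , v) → edge? u v ×-dec inner? u ×-dec inner? v)
                       (cartesianProduct (allFin n) (allFin n))

  G⁻ : EdgeRel
  G⁻ = Adj inner-edges

  G⁻⁺ : ∀ {u v} → Edge u v → Inner u → Inner v → G⁻ u v
  G⁻⁺ {u} {v} e u-inner v-inner =
    inj₁ (∈-filter⁺ _ (∈-cartesianProduct⁺ (∈-allFin u) (∈-allFin v)) (e , u-inner , v-inner))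

  G⁻⁻ : ∀ {u v} → G⁻ u v → Edge u v × Inner u × Inner v
  G⁻⁻ (inj₁ m) = proj₂ (∈-filter⁻ _ {xs = cartesianProduct (allFin n) (allFin n)} m)
  G⁻⁻ (inj₂ m) with proj₂ (∈-filter⁻ _ {xs = cartesianProduct (allFin n) (allFin n)} m)
  ... | e , v-inner , u-inner = edge-sym e , u-inner , v-inner

  A B : Subset n
  A = subset (λ v → edge? x v ×-dec ¬? (v ≟F y))
  B = subset (λ v → edge? y v ×-dec ¬? (v ≟F x))

  A⁺ : ∀ {v} → Edge x v → v ≢ y → v ∈ A
  A⁺ e v≢y = ∈subset⁺ (λ v → edge? x v ×-dec ¬? (v ≟F y)) (e , v≢y)
  B⁺ : ∀ {v} → Edge y v → v ≢ x → v ∈ B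
  B⁺ e v≢x = ∈subset⁺ (λ v → edge? y v ×-dec ¬? (v ≟F x)) (e , v≢x)
  A⁻ : ∀ {v} → v ∈ A → Edge x v × v ≢ y
  A⁻ = ∈subset⁻ (λ v → edge? x v ×-dec ¬? (v ≟F y))
  B⁻ : ∀ {v} → v ∈ B → Edge y v × v ≢ x
  B⁻ = ∈subset⁻ (λ v → edge? y v ×-dec ¬? (v ≟F x))

  _⁻ : Subset n → Subset n
  T ⁻ = T ─ pair x y

  x∉T⁻ : ∀ {T} → x ∉ T ⁻
  x∉T⁻ {T} h = ∈─⇒∉ {p = T} h (∈pair⁺ (inj₁ refl))
  y∉T⁻ : ∀ {T} → y ∉ T ⁻
  y∉T⁻ {T} h = ∈─⇒∉ {p = T} h (∈pair⁺ (inj₂ refl))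

  ∉T⁻⇒∉T : ∀ {T w} → w ∉ T ⁻ → Inner w → w ∉ T
  ∉T⁻⇒∉T w∉T⁻ w-inner w∈T = w∉T⁻ (x∈p∧x∉q⇒x∈p─q w∈T (inner∉pair w-inner))

  walk-to⇒reaches : ∀ {T U C t u} → (∀ {v} → Edge v t → Inner v → v ∈ C) →
    (∀ w → w ∉ U → w ≢ t → Inner w × w ∉ T) →
    Star (EdgeOutside G U) u t → u ≢ t → u ∉ U → Reaches G⁻ T C u
  walk-to⇒reaches C⁺ outside-U ε u≢t u∉U = ⊥-elim (u≢t refl)
  walk-to⇒reaches {t = t} {u} C⁺ outside-U (_◅_ {j = v} (e , _ , v∉U) rest) u≢t u∉U with v ≟F t
  ... | yes refl = u , C⁺ e (proj₁ (outside-U u u∉U u≢t)) , proj₂ (outside-U u u∉U u≢t) , ε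
  ... | no v≢t with walk-to⇒reaches C⁺ outside-U rest v≢t v∉U
  ...   | c , c∈C , c∉T , walk =
    c , c∈C , c∉T ,
    (G⁻⁺ e (proj₁ (outside-U u u∉U u≢t)) (proj₁ (outside-U v v∉U v≢t)) ,
     proj₂ (outside-U u u∉U u≢t) , proj₂ (outside-U v v∉U v≢t)) ◅ walk

  nonadjacent-separates : adj G x y ≡ false → ∀ T → ABSeparator G⁻ A B T → Separates G (T ⁻)
  nonadjacent-separates x≁y T T-separates = inj₁ (x , y , x∉T⁻ {T} , y∉T⁻ {T} , λ walk → never walk (inj₁ refl))
    where
    -- Invariant along a walk from x in G - T⁻: the current vertex is x,
    -- or an inner vertex reached from A in G - x - y - T.
    Reached : Fin n → Set
    Reached u = u ≡ x ⊎ (Inner u × ReachedFrom G⁻ T A u)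

    never : ∀ {u} → Star (EdgeOutside G (T ⁻)) u y → Reached u → ⊥
    never ε (inj₁ y≡x) = x≢y (sym y≡x)
    never ε (inj₂ ((_ , y≢y) , _)) = y≢y refl
    never (_◅_ {j = v} (e , u∉T⁻ , v∉T⁻) rest) reached with v ≟F y
    never (_◅_ {j = v} (e , u∉T⁻ , v∉T⁻) rest) (inj₁ refl) | yes refl with trans (sym e) x≁y
    ... | ()
    never {u} (_◅_ {j = v} (e , u∉T⁻ , v∉T⁻) rest) (inj₂ (u-inner , a , a∈A , a∉T , walk)) | yes refl =
      T-separates a u a∈A (B⁺ (edge-sym e) (proj₁ u-inner)) a∉T (∉T⁻⇒∉T u∉T⁻ u-inner) walk
    never {u} (_◅_ {j = v} (e , u∉T⁻ , v∉T⁻) rest) reached | no v≢y with v ≟F x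
    ... | yes refl = never rest (inj₁ refl)
    ... | no v≢x = never rest (inj₂ ((v≢x , v≢y) , onward reached))
      where
      v∉T : v ∉ T
      v∉T = ∉T⁻⇒∉T v∉T⁻ (v≢x , v≢y)
      onward : Reached u → ReachedFrom G⁻ T A v
      onward (inj₁ refl) = v , A⁺ e v≢y , v∉T , ε
      onward (inj₂ (u-inner , a , a∈A , a∉T , walk)) =
        a , a∈A , a∉T , walk ◅◅ ((G⁻⁺ e u-inner (v≢x , v≢y) , ∉T⁻⇒∉T u∉T⁻ u-inner , v∉T) ◅ ε)

  ∉T⁻∪⁅_⁆ : ∀ {T w} s → w ∉ T ⁻ → w ≢ s → w ∉ T ⁻ ∪ ⁅ s ⁆
  ∉T⁻∪⁅_⁆ {T} s w∉T⁻ w≢s h with ∈∪⁅⁆⁻ {S = T ⁻} h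
  ... | inj₁ w∈T⁻ = w∉T⁻ w∈T⁻
  ... | inj₂ w≡s = w≢s w≡s

  ∉T⇒∉T⁻∪⁅_⁆ : ∀ {T z} s → z ∉ T → z ≢ s → z ∉ T ⁻ ∪ ⁅ s ⁆
  ∉T⇒∉T⁻∪⁅_⁆ {T} s z∉T = ∉T⁻∪⁅ s ⁆ (λ h → z∉T (p─q⊆p T (pair x y) h))

  outside-T⁻∪⁅x⁆ : ∀ T w → w ∉ T ⁻ ∪ ⁅ x ⁆ → w ≢ y → Inner w × w ∉ T
  outside-T⁻∪⁅x⁆ T w w∉U w≢y = w-inner , ∉T⁻⇒∉T {T} (w∉U ∘ x∈p∪q⁺ ∘ inj₁) w-inner
    where
    w-inner : Inner w
    w-inner = (λ { refl → w∉U (x∈p∪q⁺ (inj₂ (x∈⁅x⁆ x))) }) , w≢y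

  outside-T⁻∪⁅y⁆ : ∀ T w → w ∉ T ⁻ ∪ ⁅ y ⁆ → w ≢ x → Inner w × w ∉ T
  outside-T⁻∪⁅y⁆ T w w∉U w≢x = w-inner , ∉T⁻⇒∉T {T} (w∉U ∘ x∈p∪q⁺ ∘ inj₁) w-inner
    where
    w-inner : Inner w
    w-inner = w≢x , (λ { refl → w∉U (x∈p∪q⁺ (inj₂ (x∈⁅x⁆ y))) })

  only-y-outside : ∀ T → (∀ z → Inner z → z ∉ T → ⊥) → ∁ (T ⁻ ∪ ⁅ x ⁆) ≡ ⁅ y ⁆
  only-y-outside T no-inner = ⊆-antisym only-y y-outside
    where
    only-y : ∁ (T ⁻ ∪ ⁅ x ⁆) ⊆ ⁅ y ⁆
    only-y {z} z∈∁U with z ≟F y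
    ... | yes refl = x∈⁅x⁆ y
    ... | no z≢y = ⊥-elim (no-inner z (proj₁ z-outside) (proj₂ z-outside))
      where
      z-outside : Inner z × z ∉ T
      z-outside = outside-T⁻∪⁅x⁆ T z (x∈∁p⇒x∉p z∈∁U) z≢y
    y-outside : ⁅ y ⁆ ⊆ ∁ (T ⁻ ∪ ⁅ x ⁆)
    y-outside z∈⁅y⁆ rewrite x∈⁅y⁆⇒x≡y y z∈⁅y⁆ = x∉p⇒x∈∁p (∉T⁻∪⁅ x ⁆ (y∉T⁻ {T}) (x≢y ∘ sym))

  cut-off-from-y : ∀ T z → Inner z → z ∉ T → ¬ Reaches G⁻ T B z → Separates G (T ⁻ ∪ ⁅ x ⁆)
  cut-off-from-y T z z-inner z∉T z↛B =
    inj₁ (z , y , z∉U , ∉T⁻∪⁅ x ⁆ (y∉T⁻ {T}) (x≢y ∘ sym) ,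
          λ walk → z↛B (walk-to⇒reaches (λ e v-inner → B⁺ (edge-sym e) (proj₁ v-inner))
                                          (outside-T⁻∪⁅x⁆ T) walk (proj₂ z-inner) z∉U))
    where
    z∉U : z ∉ T ⁻ ∪ ⁅ x ⁆
    z∉U = ∉T⇒∉T⁻∪⁅ x ⁆ z∉T (proj₁ z-inner)

  cut-off-from-x : ∀ T z → Inner z → z ∉ T → ¬ Reaches G⁻ T A z → Separates G (T ⁻ ∪ ⁅ y ⁆)
  cut-off-from-x T z z-inner z∉T z↛A =
    inj₁ (z , x , z∉U , ∉T⁻∪⁅ y ⁆ (x∉T⁻ {T}) x≢y ,
          λ walk → z↛A (walk-to⇒reaches (λ e v-inner → A⁺ (edge-sym e) (proj₂ v-inner))
                                          (outside-T⁻∪⁅y⁆ T) walk (proj₁ z-inner) z∉U))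
    where
    z∉U : z ∉ T ⁻ ∪ ⁅ y ⁆
    z∉U = ∉T⇒∉T⁻∪⁅ y ⁆ z∉T (proj₂ z-inner)

  -- Whether or not x, y are adjacent, an A–B separator T of G - x - y
  -- yields a separating set of G with at most ∣ T ∣ + 1 vertices, namely
  -- T⁻ ∪ {x} or T⁻ ∪ {y}: some inner vertex outside T misses B or A and is
  -- cut off, or else (as T separates A from B) no inner vertex is outside
  -- T, and only y is left outside T⁻ ∪ {x}.
  separator-bound : ∀ {k} → (∀ U → Separates G U → k ≤ ∣ U ∣) →
    ∀ T → ABSeparator G⁻ A B T → k ≤ suc ∣ T ∣
  separator-bound {k} κ≥k T T-separates =
    ≤-trans (κ≥k _ (proj₂ separating))
            (≤-trans (∣p∪⁅x⁆∣≤1+∣p∣ (T ⁻) (proj₁ separating)) (s≤s (∣p─q∣≤∣p∣ T (pair x y))))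
    where
    separating : Σ (Fin n) λ w → Separates G (T ⁻ ∪ ⁅ w ⁆)
    separating with any? (λ z → inner? z ×-dec ¬? (z ∈? T) ×-dec ¬? (reaches? inner-edges T B z))
                  | any? (λ z → inner? z ×-dec ¬? (z ∈? T) ×-dec ¬? (reaches? inner-edges T A z))
    ... | yes (z , z-inner , z∉T , z↛B) | _ = x , cut-off-from-y T z z-inner z∉T z↛B
    ... | no _ | yes (z , z-inner , z∉T , z↛A) = y , cut-off-from-x T z z-inner z∉T z↛A
    ... | no all↝B | no all↝A = x , inj₂ (trans (cong ∣_∣ (only-y-outside T no-inner)) (∣⁅x⁆∣≡1 y))
      where
      no-inner : ∀ z → Inner z → z ∉ T → ⊥
      no-inner z z-inner z∉T with reaches? inner-edges T A z | reaches? inner-edges T B z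
      ... | no z↛A | _ = all↝A (z , z-inner , z∉T , z↛A)
      ... | _ | no z↛B = all↝B (z , z-inner , z∉T , z↛B)
      ... | yes (a , a∈A , a∉T , z→a) | yes (b , b∈B , b∉T , z→b) =
        T-separates a b a∈A b∈B a∉T b∉T (reach-reverse Adj-sym z→a ◅◅ z→b)

  paths-nonadjacent : ∀ {k} → (∀ U → Separates G U → k ≤ ∣ U ∣) → adj G x y ≡ false → DisjointPaths G⁻ A B k
  paths-nonadjacent {k} κ≥k x≁y with menger inner-edges A B k
  ... | inj₁ paths = paths
  ... | inj₂ (T , T-separates , ∣T∣<k) =
    ⊥-elim (<⇒≱ ∣T∣<k (≤-trans (κ≥k _ (nonadjacent-separates x≁y T T-separates)) (∣p─q∣≤∣p∣ T (pair x y))))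

  paths-any : ∀ {k} → (∀ U → Separates G U → k ≤ ∣ U ∣) → DisjointPaths G⁻ A B (k ∸ 1)
  paths-any {k} κ≥k with menger inner-edges A B (k ∸ 1)
  ... | inj₁ paths = paths
  ... | inj₂ (T , T-separates , ∣T∣<k-1) = ⊥-elim (<⇒≱ ∣T∣<k-1 (∸-monoˡ-≤ 1 (separator-bound κ≥k T T-separates)))

-- Walks as strong subgraphs of the complete biorientation: the vertices of
-- a walk together with the arcs between consecutive vertices (both ways).
module _ {n : ℕ} where

  open DecMembership (_≟F_ {n}) using () renaming (_∈?_ to _∈ₗ?_)

  data Consecutive : List (Fin n) → Fin n → Fin n → Set where
    first  : ∀ {a b l} → Consecutive (a ∷ b ∷ l) a b
    first⁻ : ∀ {a b l} → Consecutive (a ∷ b ∷ l) b a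
    later  : ∀ {a l u v} → Consecutive l u v → Consecutive (a ∷ l) u v

  consecutive? : ∀ l u v → Dec (Consecutive l u v)
  consecutive? [] u v = no λ ()
  consecutive? (a ∷ []) u v = no λ { (later ()) }
  consecutive? (a ∷ b ∷ l) u v =
    map′ to from (((u ≟F a) ×-dec (v ≟F b)) ⊎-dec ((u ≟F b) ×-dec (v ≟F a)) ⊎-dec consecutive? (b ∷ l) u v)
    where
    to : (u ≡ a × v ≡ b) ⊎ (u ≡ b × v ≡ a) ⊎ Consecutive (b ∷ l) u v → Consecutive (a ∷ b ∷ l) u v
    to (inj₁ (refl , refl)) = first
    to (inj₂ (inj₁ (refl , refl))) = first⁻
    to (inj₂ (inj₂ c)) = later c
    from : Consecutive (a ∷ b ∷ l) u v → (u ≡ a × v ≡ b) ⊎ (u ≡ b × v ≡ a) ⊎ Consecutive (b ∷ l) u v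
    from first = inj₁ (refl , refl)
    from first⁻ = inj₂ (inj₁ (refl , refl))
    from (later c) = inj₂ (inj₂ c)

  consecutive-sym : ∀ {l u v} → Consecutive l u v → Consecutive l v u
  consecutive-sym first = first⁻
  consecutive-sym first⁻ = first
  consecutive-sym (later c) = later (consecutive-sym c)

  consecutive-members : ∀ {l u v} → Consecutive l u v → u ∈ₗ l × v ∈ₗ l
  consecutive-members first = here refl , there (here refl)
  consecutive-members first⁻ = there (here refl) , here refl
  consecutive-members (later c) = ×-map there there (consecutive-members c)

  connected : ∀ {l u v} → u ∈ₗ l → v ∈ₗ l → Star (Consecutive l) u v
  connected {a ∷ l} u∈l v∈l = reverse consecutive-sym (from-head u∈l) ◅◅ from-head v∈l
    where
    from-head : ∀ {a l w} → w ∈ₗ a ∷ l → Star (Consecutive (a ∷ l)) a w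
    from-head (here refl) = ε
    from-head {l = _ ∷ _} (there w∈l) = first ◅ Star-map later (from-head w∈l)

  consecutive-meets-middle : ∀ {x y u v} l → l ≢ [] → Consecutive (x ∷ (l ++ y ∷ [])) u v → u ∈ₗ l ⊎ v ∈ₗ l
  consecutive-meets-middle [] l≢[] _ = ⊥-elim (l≢[] refl)
  consecutive-meets-middle (c ∷ q) _ first = inj₂ (here refl)
  consecutive-meets-middle (c ∷ q) _ first⁻ = inj₁ (here refl)
  consecutive-meets-middle (c ∷ q) _ (later r) = before-last c q r
    where
    before-last : ∀ {y u v} c q → Consecutive (c ∷ (q ++ y ∷ [])) u v → u ∈ₗ c ∷ q ⊎ v ∈ₗ c ∷ q
    before-last c [] first = inj₁ (here refl)
    before-last c [] first⁻ = inj₂ (here refl)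
    before-last c [] (later (later ()))
    before-last c (d ∷ q) first = inj₁ (here refl)
    before-last c (d ∷ q) first⁻ = inj₂ (here refl)
    before-last c (d ∷ q) (later r) = ⊎-map there there (before-last d q r)

  walk-subgraph : List (Fin n) → Subdigraph n
  walk-subgraph l = record { verts = subset (λ v → v ∈ₗ? l) ; arcs = λ u v → does (consecutive? l u v) }

  vertex⁺ : ∀ {l v} → v ∈ₗ l → v ∈ verts (walk-subgraph l)
  vertex⁺ {l} = ∈subset⁺ (λ v → v ∈ₗ? l)
  vertex⁻ : ∀ {l v} → v ∈ verts (walk-subgraph l) → v ∈ₗ l
  vertex⁻ {l} = ∈subset⁻ (λ v → v ∈ₗ? l)
  arc⁺ : ∀ {l u v} → Consecutive l u v → Arc (walk-subgraph l) u v
  arc⁺ {l} {u} {v} = dec-true (consecutive? l u v)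
  arc⁻ : ∀ {l u v} → Arc (walk-subgraph l) u v → Consecutive l u v
  arc⁻ {l} {u} {v} arc with consecutive? l u v
  ... | yes c = c
  ... | no _ with arc
  ...   | ()

module _ {n : ℕ} (G : Graph n) where

  data IsWalk : List (Fin n) → Set where
    single : ∀ {a} → IsWalk (a ∷ [])
    step   : ∀ {a b l} → adj G a b ≡ true → IsWalk (b ∷ l) → IsWalk (a ∷ b ∷ l)

  consecutive⇒adjacent : ∀ {l u v} → IsWalk l → Consecutive l u v → adj G u v ≡ true
  consecutive⇒adjacent (step e _) first = e
  consecutive⇒adjacent {a ∷ b ∷ _} (step e _) first⁻ = trans (adj-symmetric G b a) e
  consecutive⇒adjacent (step _ w) (later c) = consecutive⇒adjacent w c

  walk-strong : ∀ {l x y} → IsWalk l → x ∈ₗ l → y ∈ₗ l →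
    IsStrongSubgraphContaining (biorient G) (pair x y) (walk-subgraph l)
  walk-strong {l} {x} {y} walk x∈l y∈l =
    (λ u v arc → consecutive⇒adjacent walk (arc⁻ {l = l} arc)) ,
    (λ u v arc → ×-map (vertex⁺ {l = l}) (vertex⁺ {l = l}) (consecutive-members (arc⁻ {l = l} arc))) ,
    (λ z∈pair → vertex⁺ {l = l} (on-walk (∈pair⁻ z∈pair))) ,
    (λ u v u∈ v∈ → Star-map (arc⁺ {l = l}) (connected (vertex⁻ {l = l} u∈) (vertex⁻ {l = l} v∈)))
    where
    on-walk : ∀ {z} → z ≡ x ⊎ z ≡ y → z ∈ₗ l
    on-walk (inj₁ refl) = x∈l
    on-walk (inj₂ refl) = y∈l

  walk-family : ∀ {p x y} (walks : Fin p → List (Fin n)) →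
    (∀ i → IsWalk (walks i) × x ∈ₗ walks i × y ∈ₗ walks i) →
    (∀ i j → i ≢ j → ∀ w → w ∈ₗ walks i → w ∈ₗ walks j → w ≡ x ⊎ w ≡ y) →
    (∀ i j → i ≢ j → ∀ u v → Consecutive (walks i) u v → Consecutive (walks j) u v → ⊥) →
    IsInternallyDisjointFamily (biorient G) (pair x y) (λ i → walk-subgraph (walks i))
  walk-family walks is-walk common-vertices common-arcs =
    (λ i → let (w , x∈ , y∈) = is-walk i in walk-strong w x∈ y∈) ,
    λ i j i≢j →
      (λ z z∈i z∈j → ∈pair⁺ (common-vertices i j i≢j z (vertex⁻ {l = walks i} z∈i) (vertex⁻ {l = walks j} z∈j))) ,
      (λ u v arc → ¬-not-arc (λ arc′ → common-arcs i j i≢j u v (arc⁻ {l = walks i} arc) (arc⁻ {l = walks j} arc′)))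
    where
    ¬-not-arc : ∀ {b} → (b ≡ true → ⊥) → b ≡ false
    ¬-not-arc {true} ¬b = ⊥-elim (¬b refl)
    ¬-not-arc {false} _ = refl

-- Lower bound κ_{x,y}(↔G) ≥ κ(G): each A–B path of G - x - y, extended by
-- x in front and y behind, is an x–y walk; disjoint paths give walks
-- sharing only x and y, and (for adjacent x, y) the edge xy is one more.
module LowerBound {n : ℕ} (G : Graph n) (x y : Fin n) (x≢y : x ≢ y) where
  open LocalMenger G x y x≢y

  x-y-walk : ABPath G⁻ A B → List (Fin n)
  x-y-walk p = x ∷ (path-vertices p ++ y ∷ [])

  tail-walk : ∀ {u} (t : Tail G⁻ A B u) → IsWalk G (vertices t ++ y ∷ [])
  tail-walk (done u∈B) = step (edge-sym (proj₁ (B⁻ u∈B))) single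
  tail-walk (step _ _ e _ t@(done _)) = step (proj₁ (G⁻⁻ e)) (tail-walk t)
  tail-walk (step _ _ e _ t@(step _ _ _ _ _)) = step (proj₁ (G⁻⁻ e)) (tail-walk t)

  x-y-walk-is-walk : ∀ p → IsWalk G (x-y-walk p)
  x-y-walk-is-walk (a , a∈A , t@(done _)) = step (proj₁ (A⁻ a∈A)) (tail-walk t)
  x-y-walk-is-walk (a , a∈A , t@(step _ _ _ _ _)) = step (proj₁ (A⁻ a∈A)) (tail-walk t)

  x-y-walk-facts : ∀ p → IsWalk G (x-y-walk p) × x ∈ₗ x-y-walk p × y ∈ₗ x-y-walk p
  x-y-walk-facts p = x-y-walk-is-walk p , here refl , there (∈-++⁺ʳ (path-vertices p) (here refl))

  path-inner : ∀ {w} p → w ∈ₗ path-vertices p → Inner w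
  path-inner (a , a∈A , t) = tail-inner t a-inner
    where
    a-inner : Inner a
    a-inner = (λ { refl → x≁x (proj₁ (A⁻ a∈A)) }) , proj₂ (A⁻ a∈A)
      where
      x≁x : adj G x x ≡ true → ⊥
      x≁x e with trans (sym e) (irrefl G x)
      ... | ()
    tail-inner : ∀ {u w} (t : Tail G⁻ A B u) → Inner u → w ∈ₗ vertices t → Inner w
    tail-inner (done _) u-inner (here refl) = u-inner
    tail-inner (step _ _ _ _ _) u-inner (here refl) = u-inner
    tail-inner (step _ _ e _ t) _ (there m) = tail-inner t (proj₂ (proj₂ (G⁻⁻ e))) m

  x-y-walk-cases : ∀ {w} p → w ∈ₗ x-y-walk p → w ≡ x ⊎ w ∈ₗ path-vertices p ⊎ w ≡ y
  x-y-walk-cases p (here refl) = inj₁ refl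
  x-y-walk-cases p (there m) with ∈-++⁻ (path-vertices p) m
  ... | inj₁ w∈p = inj₂ (inj₁ w∈p)
  ... | inj₂ (here refl) = inj₂ (inj₂ refl)

  Disjoint : ABPath G⁻ A B → ABPath G⁻ A B → Set
  Disjoint p q = ∀ w → w ∈ₗ path-vertices p → w ∈ₗ path-vertices q → ⊥

  common-vertices : ∀ p q → Disjoint p q → ∀ w → w ∈ₗ x-y-walk p → w ∈ₗ x-y-walk q → w ≡ x ⊎ w ≡ y
  common-vertices p q p∩q=∅ w w∈p w∈q with x-y-walk-cases p w∈p | x-y-walk-cases q w∈q
  ... | inj₁ w≡x | _ = inj₁ w≡x
  ... | inj₂ (inj₂ w≡y) | _ = inj₂ w≡y
  ... | inj₂ (inj₁ _) | inj₁ w≡x = inj₁ w≡x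
  ... | inj₂ (inj₁ _) | inj₂ (inj₂ w≡y) = inj₂ w≡y
  ... | inj₂ (inj₁ w∈p′) | inj₂ (inj₁ w∈q′) = ⊥-elim (p∩q=∅ w w∈p′ w∈q′)

  arc-meets-path : ∀ {u v} p → Consecutive (x-y-walk p) u v → u ∈ₗ path-vertices p ⊎ v ∈ₗ path-vertices p
  arc-meets-path (_ , _ , t) = consecutive-meets-middle (vertices t) (nonempty t)
    where
    nonempty : ∀ {u} (t : Tail G⁻ A B u) → vertices t ≢ []
    nonempty (done _) ()
    nonempty (step _ _ _ _ _) ()

  off-other-walk : ∀ p q → Disjoint p q → ∀ z → z ∈ₗ path-vertices p → z ∈ₗ x-y-walk q → ⊥
  off-other-walk p q p∩q=∅ z z∈p z∈q with path-inner p z∈p | x-y-walk-cases q z∈q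
  ... | z≢x , _ | inj₁ z≡x = z≢x z≡x
  ... | _ | inj₂ (inj₁ z∈q′) = p∩q=∅ z z∈p z∈q′
  ... | _ , z≢y | inj₂ (inj₂ z≡y) = z≢y z≡y

  common-arcs : ∀ p q → Disjoint p q → ∀ u v → Consecutive (x-y-walk p) u v → Consecutive (x-y-walk q) u v → ⊥
  common-arcs p q p∩q=∅ u v on-p on-q with arc-meets-path p on-p
  ... | inj₁ u∈p = off-other-walk p q p∩q=∅ u u∈p (proj₁ (consecutive-members on-q))
  ... | inj₂ v∈p = off-other-walk p q p∩q=∅ v v∈p (proj₂ (consecutive-members on-q))

  inner-off-edge : ∀ {z} → Inner z → z ∈ₗ x ∷ y ∷ [] → ⊥
  inner-off-edge (z≢x , _) (here z≡x) = z≢x z≡x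
  inner-off-edge (_ , z≢y) (there (here z≡y)) = z≢y z≡y

  edge-arcs : ∀ p u v → Consecutive (x ∷ y ∷ []) u v → Consecutive (x-y-walk p) u v → ⊥
  edge-arcs p u v on-edge on-p with arc-meets-path p on-p
  ... | inj₁ u∈p = inner-off-edge (path-inner p u∈p) (proj₁ (consecutive-members on-edge))
  ... | inj₂ v∈p = inner-off-edge (path-inner p v∈p) (proj₂ (consecutive-members on-edge))

  StrongFamily : ℕ → Set
  StrongFamily p = Σ (Fin p → Subdigraph n) λ F → IsInternallyDisjointFamily (biorient G) (pair x y) F

  from-paths : ∀ {k} → DisjointPaths G⁻ A B k → StrongFamily k
  from-paths (P , disjoint) =
    (λ i → walk-subgraph (x-y-walk (P i))) ,
    walk-family G (λ i → x-y-walk (P i)) (λ i → x-y-walk-facts (P i))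
      (λ i j i≢j → common-vertices (P i) (P j) (disjoint i j i≢j))
      (λ i j i≢j → common-arcs (P i) (P j) (disjoint i j i≢j))

  with-edge : ∀ {k} → adj G x y ≡ true → DisjointPaths G⁻ A B k → StrongFamily (suc k)
  with-edge x~y (P , disjoint) =
    (λ i → walk-subgraph (walks i)) , walk-family G walks facts vertices-shared arcs-shared
    where
    walks : Fin _ → List (Fin n)
    walks zero = x ∷ y ∷ []
    walks (suc i) = x-y-walk (P i)
    facts : ∀ i → IsWalk G (walks i) × x ∈ₗ walks i × y ∈ₗ walks i
    facts zero = step x~y single , here refl , there (here refl)
    facts (suc i) = x-y-walk-facts (P i)
    on-edge : ∀ {w} → w ∈ₗ x ∷ y ∷ [] → w ≡ x ⊎ w ≡ y
    on-edge (here refl) = inj₁ refl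
    on-edge (there (here refl)) = inj₂ refl
    vertices-shared : ∀ i j → i ≢ j → ∀ w → w ∈ₗ walks i → w ∈ₗ walks j → w ≡ x ⊎ w ≡ y
    vertices-shared zero _ _ w w∈i _ = on-edge w∈i
    vertices-shared (suc i) zero _ w _ w∈j = on-edge w∈j
    vertices-shared (suc i) (suc j) i≢j = common-vertices (P i) (P j) (disjoint i j (λ e → i≢j (cong suc e)))
    arcs-shared : ∀ i j → i ≢ j → ∀ u v → Consecutive (walks i) u v → Consecutive (walks j) u v → ⊥
    arcs-shared zero zero i≢j = ⊥-elim (i≢j refl)
    arcs-shared zero (suc j) _ u v on-i on-j = edge-arcs (P j) u v on-i on-j
    arcs-shared (suc i) zero _ u v on-i on-j = edge-arcs (P i) u v on-j on-i
    arcs-shared (suc i) (suc j) i≢j = common-arcs (P i) (P j) (disjoint i j (λ e → i≢j (cong suc e)))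

  lower-bound : ∀ {k} → (∀ U → Separates G U → k ≤ ∣ U ∣) → StrongFamily k
  lower-bound {k} κ≥k with adj G x y in x~y
  ... | false = from-paths (paths-nonadjacent κ≥k x~y)
  lower-bound {zero} κ≥k | true = (λ ()) , (λ ()) , (λ ())
  lower-bound {suc k} κ≥k | true = with-edge x~y (paths-any κ≥k)

module UpperBound {n : ℕ} (G : Graph n) where

  meets-or-avoids : ∀ {H : Subdigraph n} (X : Subset n) →
    (∀ u v → Arc H u v → biorient G u v ≡ true) →
    (∀ u v → Arc H u v → (u ∈ verts H) × (v ∈ verts H)) →
    ∀ {a b} → Star (Arc H) a b → a ∉ X →
    (Σ (Fin n) λ z → z ∈ X × z ∈ verts H) ⊎ Star (EdgeOutside G X) a b
  meets-or-avoids X in-G in-H ε a∉X = inj₂ ε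
  meets-or-avoids X in-G in-H (_◅_ {i = a} {j = w} arc rest) a∉X with w ∈? X
  ... | yes w∈X = inj₁ (w , w∈X , proj₂ (in-H a w arc))
  ... | no w∉X with meets-or-avoids X in-G in-H rest w∉X
  ...   | inj₁ hit = inj₁ hit
  ...   | inj₂ avoid = inj₂ ((in-G a w arc , a∉X , w∉X) ◅ avoid)

  -- x and y in different components of G - X: every subgraph of the
  -- family has its own vertex in X.
  disconnected-bound : ∀ {x y} X → x ∉ X → y ∉ X → ¬ Star (EdgeOutside G X) x y →
    ∀ p F → IsInternallyDisjointFamily (biorient G) (pair x y) F → p ≤ ∣ X ∣
  disconnected-bound {x} {y} X x∉X y∉X x↛y p F (strong , disjoint) = injection⇒≤ f f-injective X f∈X
    where
    witness : ∀ i → Σ (Fin n) λ z → z ∈ X × z ∈ verts (F i)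
    witness i with strong i
    ... | in-G , in-H , pair⊆ , connected
      with meets-or-avoids {F i} X in-G in-H
             (connected x y (pair⊆ (∈pair⁺ (inj₁ refl))) (pair⊆ (∈pair⁺ (inj₂ refl)))) x∉X
    ...   | inj₁ hit = hit
    ...   | inj₂ avoid = ⊥-elim (x↛y avoid)
    f : Fin p → Fin n
    f i = proj₁ (witness i)
    f∈X : ∀ i → f i ∈ X
    f∈X i = proj₁ (proj₂ (witness i))
    f-injective : Injective _≡_ _≡_ f
    f-injective {i} {j} fi≡fj with i ≟F j
    ... | yes i≡j = i≡j
    ... | no i≢j with ∈pair⁻ (proj₁ (disjoint i j i≢j) (f i) (proj₂ (proj₂ (witness i)))
                                (subst (_∈ verts (F j)) (sym fi≡fj) (proj₂ (proj₂ (witness j)))))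
    ...   | inj₁ fi≡x = ⊥-elim (x∉X (subst (_∈ X) fi≡x (f∈X i)))
    ...   | inj₂ fi≡y = ⊥-elim (y∉X (subst (_∈ X) fi≡y (f∈X i)))

  -- Any two vertices: each subgraph of the family leaves x by its own arc,
  -- towards its own vertex other than x, so p ≤ n - 1.
  out-arc-bound : ∀ {x y} → x ≢ y →
    ∀ p F → IsInternallyDisjointFamily (biorient G) (pair x y) F → p ≤ ∣ ∁ ⁅ x ⁆ ∣
  out-arc-bound {x} {y} x≢y p F (strong , disjoint) = injection⇒≤ f f-injective (∁ ⁅ x ⁆) f∈∁x
    where
    first-arc : ∀ {R : Fin n → Fin n → Set} {a b} → a ≢ b → Star R a b → Σ (Fin n) λ w → R a w
    first-arc a≢b ε = ⊥-elim (a≢b refl)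
    first-arc a≢b (_◅_ {j = w} r _) = w , r
    witness : ∀ i → Σ (Fin n) λ w → Arc (F i) x w
    witness i with strong i
    ... | _ , _ , pair⊆ , connected =
      first-arc x≢y (connected x y (pair⊆ (∈pair⁺ (inj₁ refl))) (pair⊆ (∈pair⁺ (inj₂ refl))))
    f : Fin p → Fin n
    f i = proj₁ (witness i)
    f∈∁x : ∀ i → f i ∈ ∁ ⁅ x ⁆
    f∈∁x i = x∉p⇒x∈∁p λ fi∈x → no-loop (x∈⁅y⁆⇒x≡y x fi∈x)
      where
      no-loop : f i ≢ x
      no-loop fi≡x with trans (sym (proj₁ (strong i) x (f i) (proj₂ (witness i))))
                              (subst (λ w → adj G x w ≡ false) (sym fi≡x) (irrefl G x))
      ... | ()
    f-injective : Injective _≡_ _≡_ f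
    f-injective {i} {j} fi≡fj with i ≟F j
    ... | yes i≡j = i≡j
    ... | no i≢j with trans (sym (proj₂ (disjoint i j i≢j) x (f i) (proj₂ (witness i))))
                          (subst (λ w → arcs (F j) x w ≡ true) (sym fi≡fj) (proj₂ (witness j)))
    ...   | ()

  ∁⁅x⁆-size : ∀ x X → ∣ ∁ X ∣ ≡ 1 → ∣ ∁ ⁅ x ⁆ ∣ ≡ ∣ X ∣
  ∁⁅x⁆-size x X ∣∁X∣≡1 = begin
    ∣ ∁ ⁅ x ⁆ ∣    ≡⟨ ∣∁p∣≡n∸∣p∣ ⁅ x ⁆ ⟩
    n ∸ ∣ ⁅ x ⁆ ∣  ≡⟨ cong (n ∸_) (trans (∣⁅x⁆∣≡1 x) (sym ∣∁X∣≡1)) ⟩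
    n ∸ ∣ ∁ X ∣    ≡⟨ sym (∣∁p∣≡n∸∣p∣ (∁ X)) ⟩
    ∣ ∁ (∁ X) ∣    ≡⟨ cong ∣_∣ (∁-involutive X) ⟩
    ∣ X ∣          ∎
    where open ≡-Reasoning

  upper-bound : 2 ≤ n → ∀ X → Separates G X →
    Σ (Fin n) λ x → Σ (Fin n) λ y → x ≢ y ×
      (∀ p F → IsInternallyDisjointFamily (biorient G) (pair x y) F → p ≤ ∣ X ∣)
  upper-bound _ X (inj₁ (x , y , x∉X , y∉X , x↛y)) =
    x , y , (λ { refl → x↛y ε }) , disconnected-bound {x} {y} X x∉X y∉X x↛y
  upper-bound (s≤s (s≤s _)) X (inj₂ ∣∁X∣≡1) =
    zero , suc zero , (λ ()) ,
    λ p F family → subst (p ≤_) (∁⁅x⁆-size zero X ∣∁X∣≡1) (out-arc-bound {zero} {suc zero} (λ ()) p F family)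

theorem2p5 : ∀ (n : ℕ) → 2 ≤ n → (G : Graph n) → (k : ℕ) →
    IsVertexConnectivity G k → IsKappa2 (biorient G) k
theorem2p5 n 2≤n G k ((X , ∣X∣≡k , X-separates) , κ≥k) with UpperBound.upper-bound G 2≤n X X-separates
... | x , y , x≢y , at-most-∣X∣ =
  (pair x y , ∣pair∣≡2 x≢y , LowerBound.lower-bound G x y x≢y κ≥k , at-most-k) , at-least-k
  where
  at-most-k : ∀ p F → IsInternallyDisjointFamily (biorient G) (pair x y) F → p ≤ k
  at-most-k p F family = subst (p ≤_) ∣X∣≡k (at-most-∣X∣ p F family)

  at-least-k : ∀ S p → ∣ S ∣ ≡ 2 → IsKappaS (biorient G) S p → k ≤ p
  at-least-k S p ∣S∣≡2 (_ , maximum) with two-element S ∣S∣≡2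
  ... | u , v , u≢v , refl = maximum k _ (proj₂ (LowerBound.lower-bound G u v u≢v κ≥k))
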